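{- For the heap update modality: \begin{align*} [\langle x\rangle:=e]b &\equiv b, \tag{E9}\\ [\langle x\rangle:=e](e'\hookrightarrow e'') &\equiv (x=e'\wedge e''=e)\vee(x\neq e'\wedge e'\hookrightarrow e''), \tag{E10}\\ [\langle x\rangle:=e](p\mathrel{*}q) &\equiv ([\langle x\rangle:=e]p\mathrel{*}q')\vee(p'\mathrel{*}[\langle x\rangle:=e]q), \tag{E11}\\ [\langle x\rangle:=e](p\mathrel{ -\!\!*}q) &\equiv p'\mathrel{ -\!\!*}[\langle x\rangle:=e]q, \tag{E12} \end{align*} where $p'$ abbreviates $p\wedge\neg(x\hookrightarrow -)$ and $q'$ abbreviates $q\wedge\neg(x\hookrightarrow -)$.
   Context: Setting (Dynamic Separation Logic, DSL). Heaps $h$ are finitely-based partial functions $\mathbb{Z}\rightharpoonup\mathbb{Z}$, stores $s$ total functions from integer variables to $\mathbb{Z}$; arithmetic expressions $e$ and Boolean expressions $b$ do not refer to the heap. $h[n:=v]$ sets location $n$ to $v$ (so $\mathrm{dom}(h[n:=v])=\mathrm{dom}(h)\cup\{n\}$). Assertions include $b$, $(e\hookrightarrow e')$ (true iff $s(e)\in\mathrm{dom}(h)$ and $h(s(e))=s(e')$), logical connectives, quantifiers, separating conjunction $p\mathrel{*}q$ (heap splits disjointly into parts satisfying $p$ and $q$), separating implication $p\mathrel{ -\!\!*}q$ (every disjoint extension heap satisfying $p$, joined with the current heap, satisfies $q$), and modalities $[S]p$. $(x\hookrightarrow -)$ abbreviates $\exists z(x\hookrightarrow z)$. The heap update pseudo-instruction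 $\langle x\rangle:=e$ maps $(h,s)$ to $(h[s(x):=s(e)],s)$ and never fails (unlike mutation, it does not require $s(x)\in\mathrm{dom}(h)$); thus $h,s\models[\langle x\rangle:=e]p$ iff $h[s(x):=s(e)],s\models p$. $\equiv$ denotes semantic equivalence. -}

module Defs where

open import Data.Nat using (ℕ)
open import Data.Integer using (ℤ) renaming (_≟_ to _≟ℤ_)
open import Data.Bool using (Bool; T)
open import Data.Maybe using (Maybe; just; nothing)
open import Data.List using (List; _∷_; _++_)
open import Data.List.Membership.Propositional using (_∈_)
open import Data.List.Membership.Propositional.Properties using (∈-++⁺ˡ; ∈-++⁺ʳ)
open import Data.List.Relation.Unary.Any using (here; there)
open import Data.Product using (Σ; ∃; ∃-syntax; _×_; _,_; proj₁; proj₂)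
open import Data.Sum using (_⊎_; inj₁; inj₂)
open import Data.Empty using (⊥)
open import Relation.Nullary using (¬_; yes; no)
open import Relation.Binary.PropositionalEquality using (_≡_; _≢_; refl; sym; trans; subst)
open import Function.Bundles using (_⇔_; mk⇔)

Var : Set
Var = ℕ

Store : Set
Store = Var → ℤ

-- arithmetic / Boolean expressions do not refer to the heap;
-- we identify them with their meaning as functions of the store
AExp : Set
AExp = Store → ℤ

BExp : Set
BExp = Store → Bool

var : Var → AExp
var x s = s x

record Heap : Set where
  field
    fn     : ℤ → Maybe ℤ
    finite : Σ (List ℤ) λ l → ∀ n → fn n ≢ nothing → n ∈ l
open Heap public

_∈dom_ : ℤ → Heap → Set
n ∈dom h = fn h n ≢ nothing

_≈ₕ_ : Heap → Heap → Set
h ≈ₕ h' = ∀ n → fn h n ≡ fn h' n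

upd-fn : (ℤ → Maybe ℤ) → ℤ → ℤ → ℤ → Maybe ℤ
upd-fn f n v m with m ≟ℤ n
... | yes _ = just v
... | no  _ = f m

_[_:=_] : Heap → ℤ → ℤ → Heap
fn (h [ n := v ]) = upd-fn (fn h) n v
finite (h [ n := v ]) = n ∷ proj₁ (finite h) , pf
  where
  pf : ∀ m → upd-fn (fn h) n v m ≢ nothing → m ∈ n ∷ proj₁ (finite h)
  pf m ne with m ≟ℤ n
  ... | yes m≡n = here m≡n
  ... | no  _   = there (proj₂ (finite h) m ne)

_⊥ₕ_ : Heap → Heap → Set
h₁ ⊥ₕ h₂ = ∀ n → fn h₁ n ≡ nothing ⊎ fn h₂ n ≡ nothing

-- union of heaps (meaningful for disjoint heaps)
union-fn : (ℤ → Maybe ℤ) → (ℤ → Maybe ℤ) → ℤ → Maybe ℤ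
union-fn f g n with f n
... | just v  = just v
... | nothing = g n

_∪ₕ_ : Heap → Heap → Heap
fn (h₁ ∪ₕ h₂) = union-fn (fn h₁) (fn h₂)
finite (h₁ ∪ₕ h₂) = proj₁ (finite h₁) ++ proj₁ (finite h₂) , pf
  where
  pf : ∀ m → union-fn (fn h₁) (fn h₂) m ≢ nothing → m ∈ proj₁ (finite h₁) ++ proj₁ (finite h₂)
  pf m ne with fn h₁ m in eq
  ... | just v  = ∈-++⁺ˡ (proj₂ (finite h₁) m (λ e → subst (λ z → z ≢ nothing) (sym eq) (λ ()) e))
  ... | nothing = ∈-++⁺ʳ (proj₁ (finite h₁)) (proj₂ (finite h₂) m ne)

Split : Heap → Heap → Heap → Set
Split h h₁ h₂ = h₁ ⊥ₕ h₂ × (∀ n → fn h n ≡ union-fn (fn h₁) (fn h₂) n)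

-- Assertions (semantically): predicates on heap/store pairs that depend
-- only on the heap as a partial function.  Every syntactic DSL assertion
-- denotes such a predicate.

record Assertion : Set₁ where
  field
    _⊨_,_ : Heap → Store → Set
    resp  : ∀ {h h' s} → h ≈ₕ h' → _⊨_,_ h s → _⊨_,_ h' s
open Assertion public

sat : Assertion → Heap → Store → Set
sat p h s = Assertion._⊨_,_ p h s

_≡ₐ_ : Assertion → Assertion → Set
p ≡ₐ q = ∀ (h : Heap) (s : Store) → sat p h s ⇔ sat q h s

private
  ≈-sym : ∀ {h h'} → h ≈ₕ h' → h' ≈ₕ h
  ≈-sym e n = sym (e n)

  ≈-upd : ∀ {h h'} n v → h ≈ₕ h' → (h [ n := v ]) ≈ₕ (h' [ n := v ])
  ≈-upd n v e m with m ≟ℤ n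
  ... | yes _ = refl
  ... | no  _ = e m

  ≈-∪ : ∀ {h h'} k → h ≈ₕ h' → (h ∪ₕ k) ≈ₕ (h' ∪ₕ k)
  ≈-∪ {h} {h'} k e m with fn h m | fn h' m | e m
  ... | just v  | .(just v) | refl = refl
  ... | nothing | .nothing  | refl = refl

  ≈-⊥ : ∀ {h h'} k → h ≈ₕ h' → h ⊥ₕ k → h' ⊥ₕ k
  ≈-⊥ k e d n with d n
  ... | inj₁ z = inj₁ (trans (sym (e n)) z)
  ... | inj₂ z = inj₂ z

⌜_⌝ : BExp → Assertion
⌜ b ⌝ = record { _⊨_,_ = λ _ s → T (b s) ; resp = λ _ z → z }

_↪_ : AExp → AExp → Assertion
e ↪ e' = record { _⊨_,_ = λ h s → fn h (e s) ≡ just (e' s)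
                ; resp = λ {h} {h'} {s} eq z → trans (sym (eq (e s))) z }

_↪- : AExp → Assertion
e ↪- = record { _⊨_,_ = λ h s → ∃[ z ] (fn h (e s) ≡ just z)
              ; resp = λ {h} {h'} {s} eq (z , w) → z , trans (sym (eq (e s))) w }

_∧ₐ_ : Assertion → Assertion → Assertion
p ∧ₐ q = record { _⊨_,_ = λ h s → sat p h s × sat q h s
                ; resp = λ {h} {h'} {s} eq (a , b) → resp p eq a , resp q eq b }

_∨ₐ_ : Assertion → Assertion → Assertion
p ∨ₐ q = record { _⊨_,_ = λ h s → sat p h s ⊎ sat q h s
                ; resp = λ { {h} {h'} {s} eq (inj₁ a) → inj₁ (resp p eq a) ; {h} {h'} {s} eq (inj₂ b) → inj₂ (resp q eq b) } }

¬ₐ_ : Assertion → Assertion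
¬ₐ p = record { _⊨_,_ = λ h s → ¬ sat p h s
              ; resp = λ {h} {h'} {s} eq n a → n (resp p (≈-sym {h} {h'} eq) a) }

_=ₐ_ : AExp → AExp → Assertion
e =ₐ e' = record { _⊨_,_ = λ _ s → e s ≡ e' s ; resp = λ _ z → z }

_≠ₐ_ : AExp → AExp → Assertion
e ≠ₐ e' = ¬ₐ (e =ₐ e')

_✱_ : Assertion → Assertion → Assertion
p ✱ q = record
  { _⊨_,_ = λ h s → ∃[ h₁ ] ∃[ h₂ ] (Split h h₁ h₂ × sat p h₁ s × sat q h₂ s)
  ; resp = λ {h} {h'} {s} eq (h₁ , h₂ , (d , e) , a , b) →
      h₁ , h₂ , (d , λ n → trans (sym (eq n)) (e n)) , a , b }

_-✱_ : Assertion → Assertion → Assertion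
p -✱ q = record
  { _⊨_,_ = λ h s → ∀ h' → h ⊥ₕ h' → sat p h' s → sat q (h ∪ₕ h') s
  ; resp = λ {h} {h₂} {s} eq f h' d a →
      resp q (≈-∪ {h} {h₂} h' eq) (f h' (≈-⊥ {h₂} {h} h' (≈-sym {h} {h₂} eq) d) a) }

[⟨_⟩:=_]_ : Var → AExp → Assertion → Assertion
[⟨ x ⟩:= e ] p = record
  { _⊨_,_ = λ h s → sat p (h [ s x := e s ]) s
  ; resp = λ {h} {h'} {s} eq a → resp p (≈-upd {h} {h'} (s x) (e s) eq) a }

_′ : Assertion → Var → Assertion
(p ′) x = p ∧ₐ (¬ₐ (var x ↪-))

-- The modality reads an assertion at h[n := v] with n = s x.  A split of h[n := v]
-- is a split of h in which the part owning n has that cell overwritten, and the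
-- other part does not contain n: that is exactly what the conjuncts ¬(x ↪ -) in
-- p′ and q′ record.  For -✱, the heaps disjoint from h[n := v] are those disjoint
-- from h that miss n, and joining with such a heap commutes with the update.
module Submission where

open import Defs
open import Data.Integer using (ℤ) renaming (_≟_ to _≟ℤ_)
open import Data.Maybe using (Maybe; just; nothing)
open import Data.Maybe.Properties using (just-injective)
open import Data.List using (_∷_)
open import Data.List.Membership.Propositional using (_∈_)
open import Data.List.Relation.Unary.Any using (here; there)
open import Data.Product using (∃-syntax; _×_; _,_; proj₁; proj₂)
open import Data.Sum using (_⊎_; inj₁; inj₂; swap)
open import Data.Empty using (⊥-elim)
open import Function using (_∘_)
open import Function.Bundles using (mk⇔)
open import Relation.Nullary using (¬_; yes; no)
open import Relation.Binary.PropositionalEquality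
  using (_≡_; _≢_; refl; sym; trans; cong; subst)

¬just⇒nothing : {c : Maybe ℤ} → ¬ (∃[ z ] c ≡ just z) → c ≡ nothing
¬just⇒nothing {just z}  ¬j = ⊥-elim (¬j (z , refl))
¬just⇒nothing {nothing} _  = refl

nothing⇒¬just : {c : Maybe ℤ} → c ≡ nothing → ¬ (∃[ z ] c ≡ just z)
nothing⇒¬just refl (_ , ())

union-fn-cong : ∀ (f f′ g g′ : ℤ → Maybe ℤ) m →
  f m ≡ f′ m → g m ≡ g′ m → union-fn f g m ≡ union-fn f′ g′ m
union-fn-cong f f′ g g′ m f≡ g≡ with f m | f′ m | f≡
... | just _  | _ | refl = refl
... | nothing | _ | refl = g≡

union-fn-justˡ : ∀ (f g : ℤ → Maybe ℤ) {m v} → f m ≡ just v → union-fn f g m ≡ just v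
union-fn-justˡ f g {m} eq with f m
... | just _ = eq

union-fn-nothingˡ : ∀ (f g : ℤ → Maybe ℤ) {m} → f m ≡ nothing → union-fn f g m ≡ g m
union-fn-nothingˡ f g {m} eq with f m
... | nothing = refl

union-fn-nothingʳ : ∀ (f g : ℤ → Maybe ℤ) {m} → g m ≡ nothing → union-fn f g m ≡ f m
union-fn-nothingʳ f g {m} eq with f m
... | just _  = refl
... | nothing = eq

union-fn-comm : ∀ (f g : ℤ → Maybe ℤ) {m} →
  f m ≡ nothing ⊎ g m ≡ nothing → union-fn f g m ≡ union-fn g f m
union-fn-comm f g (inj₁ f≡) = trans (union-fn-nothingˡ f g f≡) (sym (union-fn-nothingʳ g f f≡))
union-fn-comm f g (inj₂ g≡) = trans (union-fn-nothingʳ f g g≡) (sym (union-fn-nothingˡ g f g≡))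

_≈ₕ_except_ : Heap → Heap → ℤ → Set
h ≈ₕ h′ except n = ∀ m → m ≢ n → fn h m ≡ fn h′ m

≈ₕ-patch : ∀ h h′ n → h ≈ₕ h′ except n → fn h n ≡ fn h′ n → h ≈ₕ h′
≈ₕ-patch _ _ n eq eqₙ m with m ≟ℤ n
... | yes refl = eqₙ
... | no m≢n   = eq m m≢n

fn-[:=]-≡ : ∀ h n v {m} → m ≡ n → fn (h [ n := v ]) m ≡ just v
fn-[:=]-≡ h n v {m} m≡n with m ≟ℤ n
... | yes _   = refl
... | no m≢n  = ⊥-elim (m≢n m≡n)

fn-[:=]-≢ : ∀ h {n} v → (h [ n := v ]) ≈ₕ h except n
fn-[:=]-≢ h {n} v m m≢n with m ≟ℤ n
... | yes m≡n = ⊥-elim (m≢n m≡n)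
... | no _    = refl

set-fn : (ℤ → Maybe ℤ) → ℤ → Maybe ℤ → ℤ → Maybe ℤ
set-fn f n c m with m ≟ℤ n
... | yes _ = c
... | no _  = f m

-- Unlike _[_:=_], this may also deallocate the cell (c = nothing).
_[_:=?_] : Heap → ℤ → Maybe ℤ → Heap
fn (h [ n :=? c ]) = set-fn (fn h) n c
finite (h [ n :=? c ]) = n ∷ proj₁ (finite h) , dom⊆
  where
  dom⊆ : ∀ m → set-fn (fn h) n c m ≢ nothing → m ∈ n ∷ proj₁ (finite h)
  dom⊆ m ne with m ≟ℤ n
  ... | yes m≡n = here m≡n
  ... | no _    = there (proj₂ (finite h) m ne)

fn-[:=?]-≡ : ∀ h n c → fn (h [ n :=? c ]) n ≡ c
fn-[:=?]-≡ h n c with n ≟ℤ n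
... | yes _   = refl
... | no n≢n  = ⊥-elim (n≢n refl)

fn-[:=?]-≢ : ∀ h {n} c → (h [ n :=? c ]) ≈ₕ h except n
fn-[:=?]-≢ h {n} c m m≢n with m ≟ℤ n
... | yes m≡n = ⊥-elim (m≢n m≡n)
... | no _    = refl

⊥ₕ-resolveˡ : ∀ h₁ h₂ {n v} → h₁ ⊥ₕ h₂ → fn h₂ n ≡ just v → fn h₁ n ≡ nothing
⊥ₕ-resolveˡ _ _ {n} d h₂n with d n
... | inj₁ h₁n = h₁n
... | inj₂ h₂n′ with trans (sym h₂n) h₂n′
...   | ()

⊥ₕ-resolveʳ : ∀ h₁ h₂ {n v} → h₁ ⊥ₕ h₂ → fn h₁ n ≡ just v → fn h₂ n ≡ nothing
⊥ₕ-resolveʳ h₁ h₂ d = ⊥ₕ-resolveˡ h₂ h₁ (swap ∘ d)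

⊥ₕ-[:=]⁻ : ∀ h h′ n v → (h [ n := v ]) ⊥ₕ h′ → h ⊥ₕ h′
⊥ₕ-[:=]⁻ h h′ n v d m with m ≟ℤ n
... | yes refl = inj₂ (⊥ₕ-resolveʳ (h [ n := v ]) h′ d (fn-[:=]-≡ h n v refl))
... | no m≢n   = subst (λ c → c ≡ nothing ⊎ fn h′ m ≡ nothing) (fn-[:=]-≢ h v m m≢n) (d m)

Split-∪ : ∀ h₁ h₂ → h₁ ⊥ₕ h₂ → Split (h₁ ∪ₕ h₂) h₁ h₂
Split-∪ _ _ d = d , λ _ → refl

Split-swap : ∀ h h₁ h₂ → Split h h₁ h₂ → Split h h₂ h₁
Split-swap _ h₁ h₂ (d , join) =
  swap ∘ d , λ m → trans (join m) (union-fn-comm (fn h₁) (fn h₂) (d m))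

Split-patch : ∀ h h₁ h₂ h′ h₁′ h₂′ n → Split h h₁ h₂ →
  h′ ≈ₕ h except n → h₁′ ≈ₕ h₁ except n → h₂′ ≈ₕ h₂ except n →
  fn h₁′ n ≡ nothing ⊎ fn h₂′ n ≡ nothing →
  fn h′ n ≡ union-fn (fn h₁′) (fn h₂′) n →
  Split h′ h₁′ h₂′
Split-patch _ h₁ h₂ h′ h₁′ h₂′ n (d , join) eq eq₁ eq₂ dₙ joinₙ = d′ , join′
  where
  d′ : h₁′ ⊥ₕ h₂′
  d′ m with m ≟ℤ n
  ... | yes refl = dₙ
  ... | no m≢n rewrite eq₁ m m≢n | eq₂ m m≢n = d m
  join′ : ∀ m → fn h′ m ≡ union-fn (fn h₁′) (fn h₂′) m
  join′ m with m ≟ℤ n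
  ... | yes refl = joinₙ
  ... | no m≢n   = trans (eq m m≢n) (trans (join m)
                     (union-fn-cong (fn h₁) (fn h₁′) (fn h₂) (fn h₂′) m
                        (sym (eq₁ m m≢n)) (sym (eq₂ m m≢n))))

Split-[:=]ˡ : ∀ h h₁ h₂ n v → Split h h₁ h₂ → fn h₂ n ≡ nothing →
  Split (h [ n := v ]) (h₁ [ n := v ]) h₂
Split-[:=]ˡ h h₁ h₂ n v split h₂n =
  Split-patch h h₁ h₂ (h [ n := v ]) (h₁ [ n := v ]) h₂ n split
    (fn-[:=]-≢ h v) (fn-[:=]-≢ h₁ v) (λ _ _ → refl) (inj₂ h₂n)
    (trans (fn-[:=]-≡ h n v refl)
      (sym (union-fn-justˡ (fn (h₁ [ n := v ])) (fn h₂) {n} (fn-[:=]-≡ h₁ n v refl))))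

Split-[:=]ˡ⁻ : ∀ h h₁ h₂ n v → Split (h [ n := v ]) h₁ h₂ → fn h₂ n ≡ nothing →
  ∃[ h₁′ ] Split h h₁′ h₂ × h₁ ≈ₕ (h₁′ [ n := v ])
Split-[:=]ˡ⁻ h h₁ h₂ n v split h₂n = h₁′ , split′ , h₁≈
  where
  h₁′ = h₁ [ n :=? fn h n ]
  split′ : Split h h₁′ h₂
  split′ = Split-patch (h [ n := v ]) h₁ h₂ h h₁′ h₂ n split
    (λ m m≢n → sym (fn-[:=]-≢ h v m m≢n)) (fn-[:=?]-≢ h₁ (fn h n)) (λ _ _ → refl) (inj₂ h₂n)
    (sym (trans (union-fn-nothingʳ (fn h₁′) (fn h₂) h₂n) (fn-[:=?]-≡ h₁ n (fn h n))))
  h₁n : fn h₁ n ≡ just v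
  h₁n = trans (sym (union-fn-nothingʳ (fn h₁) (fn h₂) h₂n))
              (trans (sym (proj₂ split n)) (fn-[:=]-≡ h n v refl))
  h₁≈ : h₁ ≈ₕ (h₁′ [ n := v ])
  h₁≈ = ≈ₕ-patch h₁ (h₁′ [ n := v ]) n
    (λ m m≢n → sym (trans (fn-[:=]-≢ h₁′ v m m≢n) (fn-[:=?]-≢ h₁ (fn h n) m m≢n)))
    (trans h₁n (sym (fn-[:=]-≡ h₁′ n v refl)))

module _ (x : Var) (e : AExp) where

  [⟨⟩:=]-⌜⌝ : (b : BExp) → ([⟨ x ⟩:= e ] ⌜ b ⌝) ≡ₐ ⌜ b ⌝
  [⟨⟩:=]-⌜⌝ b h s = mk⇔ (λ z → z) (λ z → z)

  [⟨⟩:=]-↪ : (e′ e″ : AExp) →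
    ([⟨ x ⟩:= e ] (e′ ↪ e″))
      ≡ₐ ((((var x) =ₐ e′) ∧ₐ (e″ =ₐ e)) ∨ₐ (((var x) ≠ₐ e′) ∧ₐ (e′ ↪ e″)))
  [⟨⟩:=]-↪ e′ e″ h s = mk⇔ to from
    where
    n = s x
    v = e s
    to : fn (h [ n := v ]) (e′ s) ≡ just (e″ s) →
         (n ≡ e′ s × e″ s ≡ v) ⊎ (n ≢ e′ s × fn h (e′ s) ≡ just (e″ s))
    to pt with n ≟ℤ e′ s
    ... | yes n≡m = inj₁ (n≡m , just-injective (trans (sym pt) (fn-[:=]-≡ h n v (sym n≡m))))
    ... | no n≢m  = inj₂ (n≢m , trans (sym (fn-[:=]-≢ h v (e′ s) (n≢m ∘ sym))) pt)
    from : (n ≡ e′ s × e″ s ≡ v) ⊎ (n ≢ e′ s × fn h (e′ s) ≡ just (e″ s)) →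
           fn (h [ n := v ]) (e′ s) ≡ just (e″ s)
    from (inj₁ (n≡m , e″≡v)) = trans (fn-[:=]-≡ h n v (sym n≡m)) (cong just (sym e″≡v))
    from (inj₂ (n≢m , pt))   = trans (fn-[:=]-≢ h v (e′ s) (n≢m ∘ sym)) pt

  [⟨⟩:=]-✱ : (p q : Assertion) →
    ([⟨ x ⟩:= e ] (p ✱ q))
      ≡ₐ ((([⟨ x ⟩:= e ] p) ✱ ((q ′) x)) ∨ₐ (((p ′) x) ✱ ([⟨ x ⟩:= e ] q)))
  [⟨⟩:=]-✱ p q h s = mk⇔ to from
    where
    n = s x
    v = e s
    to : sat ([⟨ x ⟩:= e ] (p ✱ q)) h s →
         sat ((([⟨ x ⟩:= e ] p) ✱ ((q ′) x)) ∨ₐ (((p ′) x) ✱ ([⟨ x ⟩:= e ] q))) h s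
    to (h₁ , h₂ , split , ph₁ , qh₂) with fn h₂ n in h₂n
    ... | nothing =
      let h₁′ , split′ , h₁≈ = Split-[:=]ˡ⁻ h h₁ h₂ n v split h₂n
      in inj₁ (h₁′ , h₂ , split′ , resp p h₁≈ ph₁ , qh₂ , nothing⇒¬just h₂n)
    ... | just _ =
      let h₁n = ⊥ₕ-resolveˡ h₁ h₂ (proj₁ split) h₂n
          h₂′ , split′ , h₂≈ =
            Split-[:=]ˡ⁻ h h₂ h₁ n v (Split-swap (h [ n := v ]) h₁ h₂ split) h₁n
      in inj₂ (h₁ , h₂′ , Split-swap h h₂′ h₁ split′ ,
               (ph₁ , nothing⇒¬just h₁n) , resp q h₂≈ qh₂)
    from : sat ((([⟨ x ⟩:= e ] p) ✱ ((q ′) x)) ∨ₐ (((p ′) x) ✱ ([⟨ x ⟩:= e ] q))) h s →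
           sat ([⟨ x ⟩:= e ] (p ✱ q)) h s
    from (inj₁ (h₁ , h₂ , split , ph₁ , qh₂ , ¬h₂n)) =
      h₁ [ n := v ] , h₂ , Split-[:=]ˡ h h₁ h₂ n v split (¬just⇒nothing ¬h₂n) , ph₁ , qh₂
    from (inj₂ (h₁ , h₂ , split , (ph₁ , ¬h₁n) , qh₂)) =
      h₁ , h₂ [ n := v ] ,
      Split-swap (h [ n := v ]) (h₂ [ n := v ]) h₁
        (Split-[:=]ˡ h h₂ h₁ n v (Split-swap h h₁ h₂ split) (¬just⇒nothing ¬h₁n)) ,
      ph₁ , qh₂

  [⟨⟩:=]--✱ : (p q : Assertion) →
    ([⟨ x ⟩:= e ] (p -✱ q)) ≡ₐ (((p ′) x) -✱ ([⟨ x ⟩:= e ] q))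
  [⟨⟩:=]--✱ p q h s = mk⇔ to from
    where
    n = s x
    v = e s
    to : sat ([⟨ x ⟩:= e ] (p -✱ q)) h s → sat (((p ′) x) -✱ ([⟨ x ⟩:= e ] q)) h s
    to wand h′ d (ph′ , ¬h′n) = resp q (sym ∘ proj₂ split) (wand h′ (proj₁ split) ph′)
      where
      split = Split-[:=]ˡ (h ∪ₕ h′) h h′ n v (Split-∪ h h′ d) (¬just⇒nothing ¬h′n)
    from : sat (((p ′) x) -✱ ([⟨ x ⟩:= e ] q)) h s → sat ([⟨ x ⟩:= e ] (p -✱ q)) h s
    from wand h′ d ph′ = resp q (proj₂ split) (wand h′ h⊥h′ (ph′ , nothing⇒¬just h′n))
      where
      h′n = ⊥ₕ-resolveʳ (h [ n := v ]) h′ d (fn-[:=]-≡ h n v refl)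
      h⊥h′ = ⊥ₕ-[:=]⁻ h h′ n v d
      split = Split-[:=]ˡ (h ∪ₕ h′) h h′ n v (Split-∪ h h′ h⊥h′) h′n

lemma3p4 : (x : Var) (e : AExp) →
    -- (E9)
    ((b : BExp) → ([⟨ x ⟩:= e ] ⌜ b ⌝) ≡ₐ ⌜ b ⌝)
    -- (E10)
    × ((e′ e″ : AExp) →
         ([⟨ x ⟩:= e ] (e′ ↪ e″))
           ≡ₐ ((((var x) =ₐ e′) ∧ₐ (e″ =ₐ e)) ∨ₐ (((var x) ≠ₐ e′) ∧ₐ (e′ ↪ e″))))
    -- (E11)
    × ((p q : Assertion) →
         ([⟨ x ⟩:= e ] (p ✱ q))
           ≡ₐ ((([⟨ x ⟩:= e ] p) ✱ ((q ′) x)) ∨ₐ (((p ′) x) ✱ ([⟨ x ⟩:= e ] q))))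
    -- (E12)
    × ((p q : Assertion) →
         ([⟨ x ⟩:= e ] (p -✱ q)) ≡ₐ (((p ′) x) -✱ ([⟨ x ⟩:= e ] q)))
lemma3p4 x e = [⟨⟩:=]-⌜⌝ x e , [⟨⟩:=]-↪ x e , [⟨⟩:=]-✱ x e , [⟨⟩:=]--✱ x e
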